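{- Let $\lambda,\beta$ be partitions and $\alpha$ an integral vector with $\beta_1\le\lambda_{\ell(\lambda)}$ and $\ell(\alpha)<\ell(\lambda)$. For $m\ge0$ put $\lambda^{(m)}=\lambda\cup^m\beta+m\alpha$. Then \[ \lambda^{(n)}\cup\lambda^{(n+i)}\preceq\lambda^{(n-1)}\cup\lambda^{(n+i+1)} \] for all $n\ge1$ and $i\ge0$ such that $\lambda^{(n-1)},\lambda^{(n)},\lambda^{(n+i)},\lambda^{(n+i+1)}$ are partitions.
   Context: $\ell(\lambda)$ is the number of non-zero parts of $\lambda$; for an integral vector $\alpha$, $\ell(\alpha)$ is the index of its last non-zero entry. $\lambda\cup\mu$ is the partition obtained by sorting all parts of $\lambda$ and $\mu$ together in weakly decreasing order, and $\lambda\cup^m\beta=\lambda\cup\beta\cup\cdots\cup\beta$ with $m$ copies of $\beta$. Addition of a partition and an integral vector is entrywise (padding with zeros), and $m\alpha$ is entrywise scaling; the result is an integer vector which may or may not be a partition. Dominance order: $\mu\preceq\nu$ means $\mu_1+\cdots+\mu_j\le\nu_1+\cdots+\nu_j$ for all $j$. -}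

module Defs where

open import Data.Nat using (ℕ; zero; suc)
open import Data.Integer using (ℤ; +_; _+_; _*_; _≤_; _≤?_)
open import Data.List using (List; []; _∷_; take; foldr; map; filter; length)
open import Data.List.Relation.Unary.All using (All)
open import Data.List.Relation.Unary.Linked using (Linked)
open import Relation.Nullary using (¬_; yes; no)
open import Relation.Nullary.Decidable using (¬?)
open import Data.Integer.Properties using (_≟_)

-- Integral vectors (finitely supported, entries listed from index 1) are
-- lists of integers; trailing zeros are irrelevant for all notions below.
Vector : Set
Vector = List ℤ

_≥ᶻ_ : ℤ → ℤ → Set
x ≥ᶻ y = y ≤ x

IsPartition : Vector → Set
IsPartition v = Linked _≥ᶻ_ v × All (λ x → + 0 ≤ x) v
  where open import Data.Product using (_×_)

-- i-th entry (1-indexed), 0 beyond the list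
entry : ℕ → Vector → ℤ
entry zero    _        = + 0
entry (suc i) []       = + 0
entry (suc zero) (x ∷ _) = x
entry (suc (suc i)) (_ ∷ xs) = entry (suc i) xs

partLength : Vector → ℕ
partLength v = length (filter (λ x → ¬? (x ≟ + 0)) v)

-- ℓ(α) for an integral vector: index of its last non-zero entry (0 if none)
vecLength : Vector → ℕ
vecLength [] = 0
vecLength (x ∷ xs) with vecLength xs | x ≟ + 0
... | zero  | yes _ = 0
... | zero  | no  _ = 1
... | suc k | _     = suc (suc k)

insertDec : ℤ → Vector → Vector
insertDec x [] = x ∷ []
insertDec x (y ∷ ys) with y ≤? x
... | yes _ = x ∷ y ∷ ys
... | no  _ = y ∷ insertDec x ys

_∪ₚ_ : Vector → Vector → Vector
[] ∪ₚ μ = sortDec μ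
  where
  sortDec : Vector → Vector
  sortDec [] = []
  sortDec (x ∷ xs) = insertDec x (sortDec xs)
(x ∷ xs) ∪ₚ μ = insertDec x (xs ∪ₚ μ)

unionPow : Vector → Vector → ℕ → Vector
unionPow λ' β zero    = [] ∪ₚ λ'
unionPow λ' β (suc m) = unionPow λ' β m ∪ₚ β

_+ᵥ_ : Vector → Vector → Vector
[] +ᵥ w = w
(x ∷ xs) +ᵥ [] = x ∷ xs
(x ∷ xs) +ᵥ (y ∷ ys) = (x + y) ∷ (xs +ᵥ ys)

_·ᵥ_ : ℕ → Vector → Vector
m ·ᵥ α = map (λ a → (+ m) * a) α

lamSeq : Vector → Vector → Vector → ℕ → Vector
lamSeq λ' β α m = unionPow λ' β m +ᵥ (m ·ᵥ α)

psum : ℕ → Vector → ℤ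
psum j v = foldr _+_ (+ 0) (take j v)

_⪯_ : Vector → Vector → Set
μ ⪯ ν = ∀ (j : ℕ) → psum j μ ≤ psum j ν

-- A partition's j-th partial sum is the largest sum of j of its parts, a quantity that makes
-- sense for any list of integers and does not see the order of the entries; so
-- λ^(a) ∪ λ^(b) ⪯ λ^(c) ∪ λ^(d) follows from comparing these top sums on the concatenations.
-- Since β₁ ≤ λ_ℓ with ℓ = ℓ(λ), the first ℓ parts of λ ∪^m β are those of λ, and since
-- ℓ(α) < ℓ, adding mα changes only these, to λ_k + mα_k.  Everything else in
-- λ^(a) together with λ^(b) depends only on a + b.  For c ≤ a ≤ b ≤ d with a + b = c + d the
-- pair (λ_k + aα_k, λ_k + bα_k) is majorized by (λ_k + cα_k, λ_k + dα_k): equal sums, and the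
-- larger entry of the first pair is at most that of the second.  Replacing one pair of entries
-- by a majorizing pair never decreases a top sum.  The theorem is the case
-- (c, a, b, d) = (n − 1, n, n + i, n + i + 1).

module Submission where

open import Defs
open import Data.Nat as ℕ using (ℕ; zero; suc; z≤n; s≤s)
import Data.Nat.Properties as ℕₚ
open import Data.Integer.Base using (ℤ; +_) renaming (_≤_ to _≤ℤ_)
open import Data.Integer.Properties using (_≟_)
open import Data.List using (List; []; _∷_; _++_; take; drop; length; concat; replicate)
import Data.List.Properties as List
open import Data.List.Relation.Unary.All as All using (All; []; _∷_)
import Data.List.Relation.Unary.All.Properties as Allₚ
open import Data.List.Relation.Unary.Linked as Linked using (Linked; []; [-]; _∷_)
import Data.List.Relation.Binary.Permutation.Propositional as ↭
open ↭ using (_↭_; prep; swap; ↭-sym; ↭-trans; ↭-reflexive; module PermutationReasoning)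
open import Data.List.Relation.Binary.Permutation.Propositional.Properties
  using (++⁺; ++⁺ˡ; ++⁺ʳ; ++-comm; ++-assoc; shift; shifts; All-resp-↭)
open import Data.Product using (_×_; _,_)
open import Data.Sum using (inj₁; inj₂)
open import Relation.Nullary using (yes; no)
open import Relation.Binary.PropositionalEquality using (_≡_; refl; sym; trans; cong; cong₂; subst)

Decreasing : List ℤ → Set
Decreasing = Linked _≥ᶻ_

drop-vecLength : ∀ n xs → vecLength xs ℕ.≤ n → All (_≡ + 0) (drop n xs)
drop-vecLength zero    []       _ = []
drop-vecLength (suc n) []       _ = []
drop-vecLength n (x ∷ xs) _ with vecLength xs in ℓxs≡ | x ≟ + 0
drop-vecLength zero    (x ∷ xs) _         | zero  | yes x≡0 =
  x≡0 ∷ drop-vecLength zero xs (ℕₚ.≤-reflexive ℓxs≡)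
drop-vecLength zero    (x ∷ xs) ()        | zero  | no  _
drop-vecLength zero    (x ∷ xs) ()        | suc _ | _
drop-vecLength (suc n) (x ∷ xs) _         | zero  | _ =
  drop-vecLength n xs (subst (ℕ._≤ n) (sym ℓxs≡) z≤n)
drop-vecLength (suc n) (x ∷ xs) (s≤s ℓ≤n) | suc _ | _ =
  drop-vecLength n xs (subst (ℕ._≤ n) (sym ℓxs≡) ℓ≤n)

+ᵥ-++ : ∀ {n} xs ys zs → length xs ≡ n → (xs ++ ys) +ᵥ zs ≡ (xs +ᵥ take n zs) ++ (ys +ᵥ drop n zs)
+ᵥ-++ []       ys       zs       refl = refl
+ᵥ-++ (x ∷ xs) []       []       refl = refl
+ᵥ-++ (x ∷ xs) (y ∷ ys) []       refl = refl
+ᵥ-++ (x ∷ xs) ys       (z ∷ zs) refl = cong (_ ∷_) (+ᵥ-++ xs ys zs refl)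

module TopSum where

  open import Data.Integer.Base using (_+_; _*_; _≤_; _⊔_; nonNegative; nonPositive; +≤+)
  open import Data.Integer.Properties
  open import Algebra.Properties.CommutativeSemigroup +-commutativeSemigroup using (interchange)
  open import Relation.Binary.Bundles using (Preorder)
  import Relation.Binary.Reasoning.Preorder

  -- topSum k xs is the largest sum of at most k entries of xs.
  topSum : ℕ → List ℤ → ℤ
  topSum zero    _        = + 0
  topSum (suc k) []       = + 0
  topSum (suc k) (x ∷ xs) = topSum (suc k) xs ⊔ (x + topSum k xs)

  infix 4 _≼_ _≃_ _⊴_

  _≼_ : List ℤ → List ℤ → Set
  xs ≼ ys = ∀ k → topSum k xs ≤ topSum k ys

  _≃_ : List ℤ → List ℤ → Set
  xs ≃ ys = ∀ k → topSum k xs ≡ topSum k ys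

  ≼-preorder : Preorder _ _ _
  ≼-preorder = record
    { Carrier    = List ℤ
    ; _≈_        = _≃_
    ; _≲_        = _≼_
    ; isPreorder = record
      { isEquivalence = record
        { refl  = λ _ → refl
        ; sym   = λ xs≃ys k → sym (xs≃ys k)
        ; trans = λ xs≃ys ys≃zs k → trans (xs≃ys k) (ys≃zs k)
        }
      ; reflexive = λ xs≃ys k → ≤-reflexive (xs≃ys k)
      ; trans     = λ xs≼ys ys≼zs k → ≤-trans (xs≼ys k) (ys≼zs k)
      }
    }

  module ≼-Reasoning = Relation.Binary.Reasoning.Preorder ≼-preorder

  ≼-refl : ∀ {xs} → xs ≼ xs
  ≼-refl _ = ≤-refl

  topSum-≤-∷ : ∀ x xs k → topSum k xs ≤ topSum k (x ∷ xs)
  topSum-≤-∷ x xs zero    = ≤-refl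
  topSum-≤-∷ x xs (suc k) = i≤i⊔j _ _

  ∷⁺-≼ : ∀ x {xs ys} → xs ≼ ys → x ∷ xs ≼ x ∷ ys
  ∷⁺-≼ x xs≼ys zero    = ≤-refl
  ∷⁺-≼ x xs≼ys (suc k) = ⊔-mono-≤ (xs≼ys (suc k)) (+-monoʳ-≤ x (xs≼ys k))

  ∷⁺-≃ : ∀ x {xs ys} → xs ≃ ys → x ∷ xs ≃ x ∷ ys
  ∷⁺-≃ x xs≃ys zero    = refl
  ∷⁺-≃ x xs≃ys (suc k) = cong₂ _⊔_ (xs≃ys (suc k)) (cong (_+_ x) (xs≃ys k))

  ++⁺ˡ-≃ : ∀ zs {xs ys} → xs ≃ ys → zs ++ xs ≃ zs ++ ys
  ++⁺ˡ-≃ []       xs≃ys = xs≃ys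
  ++⁺ˡ-≃ (z ∷ zs) xs≃ys = ∷⁺-≃ z (++⁺ˡ-≃ zs xs≃ys)

  _⊴_ : ℤ × ℤ → ℤ × ℤ → Set
  (u₁ , u₂) ⊴ (v₁ , v₂) = u₁ + u₂ ≡ v₁ + v₂ × u₁ ⊔ u₂ ≤ v₁ ⊔ v₂

  +topSum≤topSum-∷∷ : ∀ {u} v₁ v₂ xs k → u ≤ v₁ ⊔ v₂ →
                      u + topSum k xs ≤ topSum (suc k) (v₁ ∷ v₂ ∷ xs)
  +topSum≤topSum-∷∷ {u} v₁ v₂ xs k u≤v₁⊔v₂ = begin
    u + t                          ≤⟨ +-monoˡ-≤ t u≤v₁⊔v₂ ⟩
    (v₁ ⊔ v₂) + t                  ≡⟨ mono-≤-distrib-⊔ {f = _+ t} (+-monoˡ-≤ t) v₁ v₂ ⟩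
    (v₁ + t) ⊔ (v₂ + t)            ≤⟨ ⊔-lub v₁-case v₂-case ⟩
    topSum (suc k) (v₁ ∷ v₂ ∷ xs)  ∎
    where
    open ≤-Reasoning
    t : ℤ
    t = topSum k xs
    v₁-case : v₁ + t ≤ topSum (suc k) (v₁ ∷ v₂ ∷ xs)
    v₁-case = ≤-trans (+-monoʳ-≤ v₁ (topSum-≤-∷ v₂ xs k)) (i≤j⊔i _ _)
    v₂-case : v₂ + t ≤ topSum (suc k) (v₁ ∷ v₂ ∷ xs)
    v₂-case = ≤-trans (i≤j⊔i _ _) (topSum-≤-∷ v₁ (v₂ ∷ xs) (suc k))

  pair-≼ : ∀ {u₁ u₂ v₁ v₂} xs → (u₁ , u₂) ⊴ (v₁ , v₂) → u₁ ∷ u₂ ∷ xs ≼ v₁ ∷ v₂ ∷ xs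
  pair-≼ xs _ zero = ≤-refl
  pair-≼ {u₁} {u₂} {v₁} {v₂} xs (sum≡ , max≤) (suc k) =
    ⊔-lub (⊔-lub tail≤ (+topSum≤topSum-∷∷ v₁ v₂ xs k u₂≤)) (head≤ k)
    where
    u₁≤ : u₁ ≤ v₁ ⊔ v₂
    u₁≤ = ≤-trans (i≤i⊔j u₁ u₂) max≤
    u₂≤ : u₂ ≤ v₁ ⊔ v₂
    u₂≤ = ≤-trans (i≤j⊔i u₁ u₂) max≤
    tail≤ : topSum (suc k) xs ≤ topSum (suc k) (v₁ ∷ v₂ ∷ xs)
    tail≤ = ≤-trans (topSum-≤-∷ v₂ xs (suc k)) (topSum-≤-∷ v₁ (v₂ ∷ xs) (suc k))
    head≤ : ∀ j → u₁ + topSum j (u₂ ∷ xs) ≤ topSum (suc j) (v₁ ∷ v₂ ∷ xs)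
    head≤ zero    = +topSum≤topSum-∷∷ v₁ v₂ xs zero u₁≤
    head≤ (suc j) = begin
      u₁ + (topSum (suc j) xs ⊔ (u₂ + t))         ≡⟨ mono-≤-distrib-⊔ {f = _+_ u₁} (+-monoʳ-≤ u₁) _ _ ⟩
      (u₁ + topSum (suc j) xs) ⊔ (u₁ + (u₂ + t))  ≤⟨ ⊔-lub (+topSum≤topSum-∷∷ v₁ v₂ xs (suc j) u₁≤) both ⟩
      topSum (suc (suc j)) (v₁ ∷ v₂ ∷ xs)         ∎
      where
      open ≤-Reasoning
      t : ℤ
      t = topSum j xs
      both : u₁ + (u₂ + t) ≤ topSum (suc (suc j)) (v₁ ∷ v₂ ∷ xs)
      both = begin
        u₁ + (u₂ + t)                        ≡⟨ sym (+-assoc u₁ u₂ t) ⟩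
        (u₁ + u₂) + t                        ≡⟨ cong (_+ t) sum≡ ⟩
        (v₁ + v₂) + t                        ≡⟨ +-assoc v₁ v₂ t ⟩
        v₁ + (v₂ + t)                        ≤⟨ +-monoʳ-≤ v₁ (i≤j⊔i _ _) ⟩
        v₁ + topSum (suc j) (v₂ ∷ xs)        ≤⟨ i≤j⊔i _ _ ⟩
        topSum (suc (suc j)) (v₁ ∷ v₂ ∷ xs)  ∎

  ↭⇒≼ : ∀ {xs ys} → xs ↭ ys → xs ≼ ys
  ↭⇒≼ ↭.refl           = ≼-refl
  ↭⇒≼ (prep x xs↭ys)   = ∷⁺-≼ x (↭⇒≼ xs↭ys)
  ↭⇒≼ (swap x y xs↭ys) k =
    ≤-trans (∷⁺-≼ x (∷⁺-≼ y (↭⇒≼ xs↭ys)) k) (pair-≼ _ (+-comm x y , ≤-reflexive (⊔-comm x y)) k)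
  ↭⇒≼ (↭.trans p q)    k = ≤-trans (↭⇒≼ p k) (↭⇒≼ q k)

  ↭⇒≃ : ∀ {xs ys} → xs ↭ ys → xs ≃ ys
  ↭⇒≃ xs↭ys k = ≤-antisym (↭⇒≼ xs↭ys k) (↭⇒≼ (↭-sym xs↭ys) k)

  ++⁺-≃ : ∀ {ws xs ys zs} → ws ≃ xs → ys ≃ zs → ws ++ ys ≃ xs ++ zs
  ++⁺-≃ {ws} {xs} {ys} {zs} ws≃xs ys≃zs = begin-equality
    ws ++ ys  ≈⟨ ++⁺ˡ-≃ ws ys≃zs ⟩
    ws ++ zs  ≈⟨ ↭⇒≃ (++-comm ws zs) ⟩
    zs ++ ws  ≈⟨ ++⁺ˡ-≃ zs ws≃xs ⟩
    zs ++ xs  ≈⟨ ↭⇒≃ (++-comm zs xs) ⟩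
    xs ++ zs  ∎
    where open ≼-Reasoning

  ∷-pair-≼ : ∀ {u₁ u₂ v₁ v₂ us₁ us₂ vs₁ vs₂} zs → (u₁ , u₂) ⊴ (v₁ , v₂) →
             us₁ ++ us₂ ++ zs ≼ vs₁ ++ vs₂ ++ zs →
             (u₁ ∷ us₁) ++ (u₂ ∷ us₂) ++ zs ≼ (v₁ ∷ vs₁) ++ (v₂ ∷ vs₂) ++ zs
  ∷-pair-≼ {u₁} {u₂} {v₁} {v₂} {us₁} {us₂} {vs₁} {vs₂} zs u⊴v us≼vs = begin
    u₁ ∷ us₁ ++ u₂ ∷ us₂ ++ zs  ≈⟨ ↭⇒≃ (prep u₁ (shift u₂ us₁ (us₂ ++ zs))) ⟩
    u₁ ∷ u₂ ∷ us₁ ++ us₂ ++ zs  ≲⟨ pair-≼ _ u⊴v ⟩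
    v₁ ∷ v₂ ∷ us₁ ++ us₂ ++ zs  ≲⟨ ∷⁺-≼ v₁ (∷⁺-≼ v₂ us≼vs) ⟩
    v₁ ∷ v₂ ∷ vs₁ ++ vs₂ ++ zs  ≈⟨ ↭⇒≃ (prep v₁ (shift v₂ vs₁ (vs₂ ++ zs))) ⟨
    v₁ ∷ vs₁ ++ v₂ ∷ vs₂ ++ zs  ∎
    where open ≼-Reasoning

  +-⊴ : ∀ h {u₁ u₂ v₁ v₂} → (u₁ , u₂) ⊴ (v₁ , v₂) → (h + u₁ , h + u₂) ⊴ (h + v₁ , h + v₂)
  +-⊴ h {u₁} {u₂} {v₁} {v₂} (sum≡ , max≤) =
    trans (interchange h u₁ h u₂) (trans (cong (_+_ (h + h)) sum≡) (sym (interchange h v₁ h v₂))) ,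
    (begin
      (h + u₁) ⊔ (h + u₂)  ≡⟨ shift-⊔ u₁ u₂ ⟨
      h + (u₁ ⊔ u₂)        ≤⟨ +-monoʳ-≤ h max≤ ⟩
      h + (v₁ ⊔ v₂)        ≡⟨ shift-⊔ v₁ v₂ ⟩
      (h + v₁) ⊔ (h + v₂)  ∎)
    where
    open ≤-Reasoning
    shift-⊔ : ∀ a b → h + (a ⊔ b) ≡ (h + a) ⊔ (h + b)
    shift-⊔ = mono-≤-distrib-⊔ {f = _+_ h} (+-monoʳ-≤ h)

  *-⊴ : ∀ {a b c d : ℕ} → c ℕ.≤ a → a ℕ.≤ b → b ℕ.≤ d → a ℕ.+ b ≡ c ℕ.+ d →
        ∀ x → (+ a * x , + b * x) ⊴ (+ c * x , + d * x)
  *-⊴ {a} {b} {c} {d} c≤a a≤b b≤d a+b≡c+d x = sum≡ , max≤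
    where
    sum≡ : + a * x + + b * x ≡ + c * x + + d * x
    sum≡ = trans (sym (*-distribʳ-+ x (+ a) (+ b)))
                 (trans (cong (λ s → + s * x) a+b≡c+d) (*-distribʳ-+ x (+ c) (+ d)))
    max≤ : + a * x ⊔ + b * x ≤ + c * x ⊔ + d * x
    max≤ with ≤-total (+ 0) x
    ... | inj₁ 0≤x = ≤-trans (⊔-lub (scale (ℕₚ.≤-trans a≤b b≤d)) (scale b≤d)) (i≤j⊔i _ _)
      where
      scale : ∀ {m n} → m ℕ.≤ n → + m * x ≤ + n * x
      scale m≤n = *-monoʳ-≤-nonNeg x {{nonNegative 0≤x}} (+≤+ m≤n)
    ... | inj₂ x≤0 = ≤-trans (⊔-lub (scale c≤a) (scale (ℕₚ.≤-trans c≤a a≤b))) (i≤i⊔j _ _)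
      where
      scale : ∀ {m n} → m ℕ.≤ n → + n * x ≤ + m * x
      scale m≤n = *-monoʳ-≤-nonPos x {{nonPositive x≤0}} (+≤+ m≤n)

  module _ {a b c d : ℕ} (scale : ∀ x → (+ a * x , + b * x) ⊴ (+ c * x , + d * x)) where

    affine-≼ : ∀ hs xs zs → (hs +ᵥ (a ·ᵥ xs)) ++ (hs +ᵥ (b ·ᵥ xs)) ++ zs
                          ≼ (hs +ᵥ (c ·ᵥ xs)) ++ (hs +ᵥ (d ·ᵥ xs)) ++ zs
    affine-≼ []       []       zs = ≼-refl
    affine-≼ (h ∷ hs) []       zs = ≼-refl
    affine-≼ []       (x ∷ xs) zs = ∷-pair-≼ zs (scale x) (affine-≼ [] xs zs)
    affine-≼ (h ∷ hs) (x ∷ xs) zs = ∷-pair-≼ zs (+-⊴ h (scale x)) (affine-≼ hs xs zs)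

  topSum-zeros : ∀ {zs} → All (_≡ + 0) zs → ∀ k → topSum k zs ≡ + 0
  topSum-zeros []            zero    = refl
  topSum-zeros []            (suc k) = refl
  topSum-zeros (refl ∷ zs≡0) zero    = refl
  topSum-zeros (refl ∷ zs≡0) (suc k)
    rewrite topSum-zeros zs≡0 (suc k) | topSum-zeros zs≡0 k = refl

  +ᵥ-zeros-≃ : ∀ xs {zs} → All (_≡ + 0) zs → xs +ᵥ zs ≃ xs
  +ᵥ-zeros-≃ []       zs≡0          zero    = refl
  +ᵥ-zeros-≃ []       zs≡0          (suc k) = topSum-zeros zs≡0 (suc k)
  +ᵥ-zeros-≃ (x ∷ xs) []                    = λ _ → refl
  +ᵥ-zeros-≃ (x ∷ xs) (refl ∷ zs≡0) rewrite +-identityʳ x = ∷⁺-≃ x (+ᵥ-zeros-≃ xs zs≡0)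

module Sorting where

  open TopSum
  open import Data.Integer.Base using (_+_; _≤_; _⊔_)
  open import Data.Integer.Properties
  open import Algebra.Properties.CommutativeSemigroup +-commutativeSemigroup using (x∙yz≈y∙xz)
  open import Relation.Binary.Properties.DecTotalOrder ≤-decTotalOrder
    using (≥-decTotalOrder; ≥-totalOrder; ≥-trans)
  open import Data.List.Sort.InsertionSort.Base ≥-decTotalOrder using (insert; sort) public
  open import Data.List.Sort.InsertionSort.Properties ≥-decTotalOrder using (sort-↭; sort-↗) public
  open import Data.List.Relation.Unary.Sorted.TotalOrder.Properties using (↗↭↗⇒≋)
  open import Data.List.Relation.Unary.AllPairs as AllPairs using ()
  open import Data.List.Relation.Unary.Linked.Properties using (Linked⇒AllPairs)
  open import Data.List.Relation.Binary.Pointwise using (Pointwise-≡⇒≡)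
  open import Relation.Binary.PropositionalEquality using (isEquivalence; module ≡-Reasoning)

  decreasing-head : ∀ {x xs} → Decreasing (x ∷ xs) → All (_≤ x) xs
  decreasing-head x∷xs↘ = AllPairs.head (Linked⇒AllPairs ≥-trans x∷xs↘)

  decreasing-↭⇒≡ : ∀ {xs ys} → Decreasing xs → Decreasing ys → xs ↭ ys → xs ≡ ys
  decreasing-↭⇒≡ xs↘ ys↘ xs↭ys =
    Pointwise-≡⇒≡ (↗↭↗⇒≋ ≥-totalOrder xs↘ ys↘ (↭.↭⇒↭ₛ′ isEquivalence xs↭ys))

  insertDec≡insert : ∀ x xs → insertDec x xs ≡ insert x xs
  insertDec≡insert x []       = refl
  insertDec≡insert x (y ∷ ys) with y ≤? x
  ... | yes _ = refl
  ... | no  _ = cong (y ∷_) (insertDec≡insert x ys)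

  ∪ₚ≡sort : ∀ xs ys → xs ∪ₚ ys ≡ sort (xs ++ ys)
  ∪ₚ≡sort []       []       = refl
  ∪ₚ≡sort []       (y ∷ ys) = trans (insertDec≡insert y ([] ∪ₚ ys)) (cong (insert y) (∪ₚ≡sort [] ys))
  ∪ₚ≡sort (x ∷ xs) ys       = trans (insertDec≡insert x (xs ∪ₚ ys)) (cong (insert x) (∪ₚ≡sort xs ys))

  ∪ₚ-↭ : ∀ xs ys → xs ∪ₚ ys ↭ xs ++ ys
  ∪ₚ-↭ xs ys = ↭-trans (↭-reflexive (∪ₚ≡sort xs ys)) (sort-↭ (xs ++ ys))

  ∪ₚ-decreasing : ∀ xs ys → Decreasing (xs ∪ₚ ys)
  ∪ₚ-decreasing xs ys = subst Decreasing (sym (∪ₚ≡sort xs ys)) (sort-↗ (xs ++ ys))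

  psum-suc≤ : ∀ {x} xs k → All (_≤ x) xs → + 0 ≤ x → psum (suc k) xs ≤ x + psum k xs
  psum-suc≤ []       zero    _              0≤x = +-monoˡ-≤ (+ 0) 0≤x
  psum-suc≤ []       (suc k) _              0≤x = +-monoˡ-≤ (+ 0) 0≤x
  psum-suc≤ (y ∷ ys) zero    (y≤x ∷ _)     _   = +-monoˡ-≤ (+ 0) y≤x
  psum-suc≤ {x} (y ∷ ys) (suc k) (y≤x ∷ ys≤x) 0≤x =
    ≤-trans (+-monoʳ-≤ y (psum-suc≤ ys k ys≤x 0≤x)) (≤-reflexive (x∙yz≈y∙xz y x _))

  psum≡topSum : ∀ {xs} → Decreasing xs → All (+ 0 ≤_) xs → ∀ k → psum k xs ≡ topSum k xs
  psum≡topSum {[]}     _   _              zero    = refl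
  psum≡topSum {[]}     _   _              (suc k) = refl
  psum≡topSum {x ∷ xs} _   _              zero    = refl
  psum≡topSum {x ∷ xs} x∷xs↘ (0≤x ∷ xs≥0) (suc k) = begin
    x + psum k xs                      ≡⟨ i≤j⇒i⊔j≡j (psum-suc≤ xs k (decreasing-head x∷xs↘) 0≤x) ⟨
    psum (suc k) xs ⊔ (x + psum k xs)  ≡⟨ cong₂ (λ s t → s ⊔ (x + t)) (ih (suc k)) (ih k) ⟩
    topSum (suc k) (x ∷ xs)            ∎
    where
    open ≡-Reasoning
    ih : ∀ j → psum j xs ≡ topSum j xs
    ih = psum≡topSum (Linked.tail x∷xs↘) xs≥0

  psum-∪ₚ : ∀ xs ys → All (+ 0 ≤_) (xs ++ ys) → ∀ k → psum k (xs ∪ₚ ys) ≡ topSum k (xs ++ ys)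
  psum-∪ₚ xs ys xs++ys≥0 k =
    trans (psum≡topSum (∪ₚ-decreasing xs ys) (All-resp-↭ (↭-sym (∪ₚ-↭ xs ys)) xs++ys≥0) k)
          (↭⇒≃ (∪ₚ-↭ xs ys) k)

  ∪ₚ-⪯ : ∀ {xs ys zs ws} → All (+ 0 ≤_) xs → All (+ 0 ≤_) ys → All (+ 0 ≤_) zs → All (+ 0 ≤_) ws →
         xs ++ ys ≼ zs ++ ws → (xs ∪ₚ ys) ⪯ (zs ∪ₚ ws)
  ∪ₚ-⪯ {xs} {ys} {zs} {ws} xs≥0 ys≥0 zs≥0 ws≥0 xs++ys≼zs++ws j = begin
    psum j (xs ∪ₚ ys)    ≡⟨ psum-∪ₚ xs ys (Allₚ.++⁺ xs≥0 ys≥0) j ⟩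
    topSum j (xs ++ ys)  ≤⟨ xs++ys≼zs++ws j ⟩
    topSum j (zs ++ ws)  ≡⟨ psum-∪ₚ zs ws (Allₚ.++⁺ zs≥0 ws≥0) j ⟨
    psum j (zs ∪ₚ ws)    ∎
    where open ≤-Reasoning

  ∷-decreasing : ∀ {x xs} → All (_≤ x) xs → Decreasing xs → Decreasing (x ∷ xs)
  ∷-decreasing []        _   = [-]
  ∷-decreasing (y≤x ∷ _) xs↘ = y≤x ∷ xs↘

  take-++-decreasing : ∀ n xs {ys} → 1 ℕ.≤ n → n ℕ.≤ length xs → Decreasing xs → Decreasing ys →
                       All (_≤ entry n xs) ys → Decreasing (take n xs ++ ys)
  take-++-decreasing 1 (x ∷ xs) _ _ _ ys↘ ys≤x = ∷-decreasing ys≤x ys↘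
  take-++-decreasing (suc (suc n)) (x ∷ y ∷ xs) _ (s≤s n<len) (y≤x ∷ xs↘) ys↘ ys≤ =
    y≤x ∷ take-++-decreasing (suc n) (y ∷ xs) (s≤s z≤n) n<len xs↘ ys↘ ys≤
  take-++-decreasing (suc (suc n)) (x ∷ []) _ (s≤s ()) _ _ _

  drop-≤-entry : ∀ n xs → 1 ℕ.≤ n → Decreasing xs → All (_≤ entry n xs) (drop n xs)
  drop-≤-entry 1             []       _ _     = []
  drop-≤-entry 1             (x ∷ xs) _ x∷xs↘ = decreasing-head x∷xs↘
  drop-≤-entry (suc (suc n)) []       _ _     = []
  drop-≤-entry (suc (suc n)) (x ∷ xs) _ x∷xs↘ = drop-≤-entry (suc n) xs (s≤s z≤n) (Linked.tail x∷xs↘)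

  unionPow-decreasing : ∀ xs ys m → Decreasing (unionPow xs ys m)
  unionPow-decreasing xs ys zero    = ∪ₚ-decreasing [] xs
  unionPow-decreasing xs ys (suc m) = ∪ₚ-decreasing (unionPow xs ys m) ys

  unionPow-↭ : ∀ xs ys m → unionPow xs ys m ↭ xs ++ concat (replicate m ys)
  unionPow-↭ xs ys zero    = ↭-trans (∪ₚ-↭ [] xs) (↭-reflexive (sym (List.++-identityʳ xs)))
  unionPow-↭ xs ys (suc m) = begin
    unionPow xs ys m ∪ₚ ys   ↭⟨ ∪ₚ-↭ (unionPow xs ys m) ys ⟩
    unionPow xs ys m ++ ys   ↭⟨ ++⁺ʳ ys (unionPow-↭ xs ys m) ⟩
    (xs ++ yss) ++ ys        ↭⟨ ++-assoc xs yss ys ⟩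
    xs ++ yss ++ ys          ↭⟨ ++⁺ˡ xs (++-comm yss ys) ⟩
    xs ++ ys ++ yss          ∎
    where
    open PermutationReasoning
    yss : List ℤ
    yss = concat (replicate m ys)

module Sequence (λ' β α : Vector) (λ↘ : Decreasing λ') (β↘ : Decreasing β)
  (β₁≤λₗ : entry 1 β ≤ℤ entry (partLength λ') λ')
  (ℓα<ℓλ : vecLength α ℕ.< partLength λ') where

  open TopSum
  open Sorting
  open import Data.Integer.Base using (_*_; _≤_)
  open import Data.Integer.Properties using (≤-refl; ≤-trans; *-zeroʳ)

  ℓ : ℕ
  ℓ = partLength λ'

  H R : Vector
  H = take ℓ λ'
  R = drop ℓ λ'

  βs : ℕ → Vector
  βs m = concat (replicate m β)

  rest : ℕ → Vector
  rest m = sort (R ++ βs m)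

  front : ℕ → Vector
  front m = H +ᵥ (m ·ᵥ take ℓ α)

  common : ℕ → Vector
  common s = R ++ R ++ βs s

  1≤ℓ : 1 ℕ.≤ ℓ
  1≤ℓ = ℕₚ.≤-trans (s≤s z≤n) ℓα<ℓλ

  ℓ≤length : ℓ ℕ.≤ length λ'
  ℓ≤length = List.length-filter _ λ'

  βs-+ : ∀ a b → βs (a ℕ.+ b) ≡ βs a ++ βs b
  βs-+ zero    b = refl
  βs-+ (suc a) b = trans (cong (β ++_) (βs-+ a b)) (sym (List.++-assoc β (βs a) (βs b)))

  βs-≤ : ∀ m → All (_≤ entry ℓ λ') (βs m)
  βs-≤ m = Allₚ.concat⁺ (Allₚ.replicate⁺ m (All.map (λ b≤β₁ → ≤-trans b≤β₁ β₁≤λₗ) (≤-first β β↘)))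
    where
    ≤-first : ∀ xs → Decreasing xs → All (_≤ entry 1 xs) xs
    ≤-first []       _     = []
    ≤-first (x ∷ xs) x∷xs↘ = ≤-refl ∷ decreasing-head x∷xs↘

  unionPow≡H++rest : ∀ m → unionPow λ' β m ≡ H ++ rest m
  unionPow≡H++rest m = decreasing-↭⇒≡ (unionPow-decreasing λ' β m) H++rest↘ (begin
    unionPow λ' β m    ↭⟨ unionPow-↭ λ' β m ⟩
    λ' ++ βs m         ≡⟨ cong (_++ βs m) (List.take++drop≡id ℓ λ') ⟨
    (H ++ R) ++ βs m   ↭⟨ ++-assoc H R (βs m) ⟩
    H ++ R ++ βs m     ↭⟨ ++⁺ˡ H (sort-↭ (R ++ βs m)) ⟨
    H ++ rest m        ∎)
    where
    open PermutationReasoning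
    H++rest↘ : Decreasing (H ++ rest m)
    H++rest↘ = take-++-decreasing ℓ λ' 1≤ℓ ℓ≤length λ↘ (sort-↗ (R ++ βs m))
      (All-resp-↭ (↭-sym (sort-↭ (R ++ βs m))) (Allₚ.++⁺ (drop-≤-entry ℓ λ' 1≤ℓ λ↘) (βs-≤ m)))

  lamSeq≃front++rest : ∀ m → lamSeq λ' β α m ≃ front m ++ rest m
  lamSeq≃front++rest m = begin-equality
    lamSeq λ' β α m
      ≡⟨ cong (_+ᵥ (m ·ᵥ α)) (unionPow≡H++rest m) ⟩
    (H ++ rest m) +ᵥ (m ·ᵥ α)
      ≡⟨ +ᵥ-++ H (rest m) (m ·ᵥ α) length-H ⟩
    (H +ᵥ take ℓ (m ·ᵥ α)) ++ (rest m +ᵥ drop ℓ (m ·ᵥ α))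
      ≡⟨ cong₂ _++_ (cong (H +ᵥ_) (List.take-map ℓ α)) refl ⟩
    front m ++ (rest m +ᵥ drop ℓ (m ·ᵥ α))
      ≈⟨ ++⁺ˡ-≃ (front m) (+ᵥ-zeros-≃ (rest m) zeros) ⟩
    front m ++ rest m
      ∎
    where
    open ≼-Reasoning
    length-H : length H ≡ ℓ
    length-H = trans (List.length-take ℓ λ') (ℕₚ.m≤n⇒m⊓n≡m ℓ≤length)
    zeros : All (_≡ + 0) (drop ℓ (m ·ᵥ α))
    zeros = subst (All (_≡ + 0)) (sym (List.drop-map ℓ α))
      (Allₚ.map⁺ (All.map (λ a≡0 → trans (cong (_*_ (+ m)) a≡0) (*-zeroʳ (+ m)))
                          (drop-vecLength ℓ α (ℕₚ.<⇒≤ ℓα<ℓλ))))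

  rest-++-↭ : ∀ a b → rest a ++ rest b ↭ common (a ℕ.+ b)
  rest-++-↭ a b = begin
    rest a ++ rest b                ↭⟨ ++⁺ (sort-↭ (R ++ βs a)) (sort-↭ (R ++ βs b)) ⟩
    (R ++ βs a) ++ (R ++ βs b)      ↭⟨ ++-assoc R (βs a) (R ++ βs b) ⟩
    R ++ βs a ++ R ++ βs b          ↭⟨ ++⁺ˡ R (shifts (βs a) R) ⟩
    R ++ R ++ βs a ++ βs b          ≡⟨ cong (λ xs → R ++ R ++ xs) (βs-+ a b) ⟨
    common (a ℕ.+ b)                ∎
    where open PermutationReasoning

  lamSeq-++-≃ : ∀ a b → lamSeq λ' β α a ++ lamSeq λ' β α b ≃ front a ++ front b ++ common (a ℕ.+ b)
  lamSeq-++-≃ a b = begin-equality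
    lamSeq λ' β α a ++ lamSeq λ' β α b          ≈⟨ ++⁺-≃ (lamSeq≃front++rest a) (lamSeq≃front++rest b) ⟩
    (front a ++ rest a) ++ (front b ++ rest b)  ≈⟨ ↭⇒≃ regroup ⟩
    front a ++ front b ++ common (a ℕ.+ b)      ∎
    where
    open ≼-Reasoning
    regroup : (front a ++ rest a) ++ (front b ++ rest b) ↭ front a ++ front b ++ common (a ℕ.+ b)
    regroup = ↭-trans (++-assoc (front a) (rest a) (front b ++ rest b))
      (++⁺ˡ (front a) (↭-trans (shifts (rest a) (front b)) (++⁺ˡ (front b) (rest-++-↭ a b))))

  lamSeq-++-≼ : ∀ {a b c d} → c ℕ.≤ a → a ℕ.≤ b → b ℕ.≤ d → a ℕ.+ b ≡ c ℕ.+ d →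
                lamSeq λ' β α a ++ lamSeq λ' β α b ≼ lamSeq λ' β α c ++ lamSeq λ' β α d
  lamSeq-++-≼ {a} {b} {c} {d} c≤a a≤b b≤d a+b≡c+d = begin
    lamSeq λ' β α a ++ lamSeq λ' β α b      ≈⟨ lamSeq-++-≃ a b ⟩
    front a ++ front b ++ common (a ℕ.+ b)  ≲⟨ fronts-≼ ⟩
    front c ++ front d ++ common (a ℕ.+ b)  ≡⟨ cong (λ s → front c ++ front d ++ common s) a+b≡c+d ⟩
    front c ++ front d ++ common (c ℕ.+ d)  ≈⟨ lamSeq-++-≃ c d ⟨
    lamSeq λ' β α c ++ lamSeq λ' β α d      ∎
    where
    open ≼-Reasoning
    fronts-≼ : front a ++ front b ++ common (a ℕ.+ b) ≼ front c ++ front d ++ common (a ℕ.+ b)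
    fronts-≼ = affine-≼ {a} {b} {c} {d} (*-⊴ c≤a a≤b b≤d a+b≡c+d) H (take ℓ α) (common (a ℕ.+ b))

open import Data.Nat using (ℕ; suc; _+_; _<_; _≤_; _∸_)
open import Data.Integer using (ℤ) renaming (_≤_ to _≤ℤ_)

proposition5p5 : (λ' β α : Vector) → IsPartition λ' → IsPartition β →
    entry 1 β ≤ℤ entry (partLength λ') λ' → vecLength α < partLength λ' →
    (n i : ℕ) → 1 ≤ n →
    IsPartition (lamSeq λ' β α (n ∸ 1)) → IsPartition (lamSeq λ' β α n) →
    IsPartition (lamSeq λ' β α (n + i)) → IsPartition (lamSeq λ' β α (n + i + 1)) →
    (lamSeq λ' β α n ∪ₚ lamSeq λ' β α (n + i))
      ⪯ (lamSeq λ' β α (n ∸ 1) ∪ₚ lamSeq λ' β α (n + i + 1))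
proposition5p5 λ' β α (λ↘ , _) (β↘ , _) β₁≤λₗ ℓα<ℓλ (suc n) i _
  (_ , λⁿ⁻¹≥0) (_ , λⁿ≥0) (_ , λⁿ⁺ⁱ≥0) (_ , λⁿ⁺ⁱ⁺¹≥0) =
  ∪ₚ-⪯ λⁿ≥0 λⁿ⁺ⁱ≥0 λⁿ⁻¹≥0 λⁿ⁺ⁱ⁺¹≥0
    (lamSeq-++-≼ (ℕₚ.n≤1+n n) (ℕₚ.m≤m+n (suc n) i) (ℕₚ.m≤m+n (suc n + i) 1) sum≡)
  where
  open Sorting using (∪ₚ-⪯)
  open Sequence λ' β α λ↘ β↘ β₁≤λₗ ℓα<ℓλ using (lamSeq-++-≼)
  sum≡ : suc n + (suc n + i) ≡ n + (suc n + i + 1)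
  sum≡ = sym (trans (cong (_+_ n) (ℕₚ.+-comm (suc n + i) 1)) (ℕₚ.+-suc n (suc n + i)))
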